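{- Let $N_1,\dots,N_d$ be positive integers. For any integer $s\ge2$ and any $X\subseteq[N_1]\times\cdots\times[N_d]$, \[ \sum_{\mathbf{b}\in\mathbb{Z}^d\setminus\{\mathbf{0}\}}|U^d(X,\mathbf{b},s)|\le|X|\cdot\prod_{i=1}^d\Big(4\frac{N_i}{s}+1\Big). \]
   Context: $[n]=\{1,\dots,n\}$. For $\mathbf{b}\in\mathbb{Z}^d\setminus\{\mathbf{0}\}$, $\mathbf{x}\equiv\mathbf{x}'\pmod{\mathbf{b}}$ means $\mathbf{x}-\mathbf{x}'=k\mathbf{b}$ for some integer $k$. For a positive integer $s$, a finite $X\subseteq\mathbb{Z}^d$ and $\mathbf{b}\ne\mathbf{0}$, $U^d(X,\mathbf{b},s)$ is the set of $x\in X$ with $|\{x'\in X:x'\equiv x\pmod{\mathbf{b}}\}|\ge s$. -}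

module Defs where

open import Data.Nat as ℕ using (ℕ; zero; suc)
open import Data.Integer as ℤ using (ℤ; +_)
open import Data.Fin as F using (Fin)
open import Data.Vec as Vec using (Vec; lookup; zipWith; replicate)
open import Data.List using (List; length)
open import Data.List.Membership.Propositional using (_∈_)
open import Data.List.Relation.Unary.All using (All)
open import Data.List.Relation.Unary.Unique.Propositional using (Unique)
open import Data.Product using (_×_; ∃)
open import Relation.Binary.PropositionalEquality using (_≡_)

Point : ℕ → Set
Point d = Vec ℤ d

𝟎 : (d : ℕ) → Point d
𝟎 d = replicate d (+ 0)

_≡_[mod_] : ∀ {d} → Point d → Point d → Point d → Set
x ≡ x' [mod b ] = ∃ λ (k : ℤ) → zipWith ℤ._-_ x x' ≡ Vec.map (k ℤ.*_) b

InBox : ∀ {d} → (Fin d → ℕ) → Point d → Set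
InBox {d} N x = (i : Fin d) → (+ 1 ℤ.≤ lookup x i) × (lookup x i ℤ.≤ + N i)

-- x ∈ U^d(X, b, s), where the finite set X is a duplicate-free list:
-- x ∈ X and the set {x' ∈ X : x' ≡ x (mod b)} has at least s elements,
-- i.e. contains s distinct elements (given as a duplicate-free list of length s).
InU : ∀ {d} → List (Point d) → Point d → ℕ → Point d → Set
InU {d} X b s x =
  (x ∈ X) × ∃ λ (L : List (Point d)) →
    Unique L × (length L ≡ s) × All (λ x' → (x' ∈ X) × (x' ≡ x [mod b ])) L

prodFin : ∀ {d} → (Fin d → ℕ) → ℕ
prodFin {zero} f = 1
prodFin {suc d} f = f F.zero ℕ.* prodFin (λ i → f (F.suc i))

-- If x ∈ U(X, b, s), then X contains s distinct points x + k b; the two with extreme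
-- coefficients k differ by (k_max - k_min) b with k_max - k_min ≥ s - 1, and as both lie
-- in the box, (s - 1) ∣bᵢ∣ ≤ Nᵢ in every coordinate.  Hence every pair (b, x) counted on
-- the left lies in B × X, where B is the box of vectors with ∣bᵢ∣ ≤ ⌊Nᵢ / (s - 1)⌋, and
-- s (2 ⌊Nᵢ / (s - 1)⌋ + 1) ≤ 4 Nᵢ + s because s ≤ 2 (s - 1).
module Submission where

open import Defs
open import Data.Nat as ℕ using (ℕ; zero; suc; z≤n; s≤s)
import Data.Nat.Properties as ℕP
open import Data.Integer using (ℤ; +_; -[1+_]; ∣_∣; +≤+; -≤+; -≤-)
import Data.Integer.Properties as ℤP
open import Data.Fin as F using (Fin)
open import Data.Vec as Vec using ([]; _∷_; lookup; zipWith; tabulate)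
import Data.Vec.Properties as Vecₚ
open import Data.List using (List; []; _∷_; [_]; _++_; length; map; applyUpTo; cartesianProductWith; cartesianProduct)
open import Data.List.Properties using (length-++; length-map; length-applyUpTo)
open import Data.List.Membership.Propositional using (_∈_)
open import Data.List.Membership.Propositional.Properties using (∈-∃++; ∈-applyUpTo⁺; ∈-cartesianProductWith⁺; ∈-cartesianProduct⁺)
open import Data.List.Relation.Binary.Subset.Propositional using (_⊆_)
open import Data.List.Relation.Unary.Any using (here; there)
open import Data.List.Relation.Unary.All as All using (All; []; _∷_)
open import Data.List.Relation.Unary.AllPairs using ([]; _∷_)
open import Data.List.Relation.Unary.Unique.Propositional using (Unique)
open import Data.Product using (_×_; _,_; ∃)
open import Data.Sum using ([_,_]′)
open import Data.Empty using (⊥-elim)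
open import Function using (id; _∘_)
open import Relation.Binary.PropositionalEquality hiding ([_])

module _ {A : Set} where
  open import Data.Nat using (_≤_)

  ∈-++⁻-≢ : ∀ {x y : A} xs ys → y ∈ xs ++ x ∷ ys → y ≢ x → y ∈ xs ++ ys
  ∈-++⁻-≢ []       ys (here y≡x) y≢x = ⊥-elim (y≢x y≡x)
  ∈-++⁻-≢ []       ys (there y∈ys) _ = y∈ys
  ∈-++⁻-≢ (_ ∷ xs) ys (here y≡z) _   = here y≡z
  ∈-++⁻-≢ (_ ∷ xs) ys (there y∈) y≢x = there (∈-++⁻-≢ xs ys y∈ y≢x)

  Unique⇒length≤ : ∀ {xs ys : List A} → Unique xs → xs ⊆ ys → length xs ≤ length ys
  Unique⇒length≤ {[]}     _            _     = z≤n
  Unique⇒length≤ {x ∷ xs} (x∉xs ∷ uxs) xs⊆ys with ∈-∃++ (xs⊆ys (here refl))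
  ... | ys₁ , ys₂ , refl = begin
      suc (length xs)                 ≤⟨ s≤s (Unique⇒length≤ uxs xs⊆ys₁++ys₂) ⟩
      suc (length (ys₁ ++ ys₂))       ≡⟨ cong suc (length-++ ys₁) ⟩
      suc (length ys₁ ℕ.+ length ys₂) ≡⟨ ℕP.+-suc (length ys₁) (length ys₂) ⟨
      length ys₁ ℕ.+ suc (length ys₂) ≡⟨ length-++ ys₁ ⟨
      length (ys₁ ++ x ∷ ys₂)         ∎
    where
    open ℕP.≤-Reasoning
    xs⊆ys₁++ys₂ : xs ⊆ ys₁ ++ ys₂
    xs⊆ys₁++ys₂ y∈xs =
      ∈-++⁻-≢ ys₁ ys₂ (xs⊆ys (there y∈xs)) (λ y≡x → All.lookup x∉xs y∈xs (sym y≡x))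

length-cartesianProductWith : ∀ {A B C : Set} (f : A → B → C) xs ys →
  length (cartesianProductWith f xs ys) ≡ length xs ℕ.* length ys
length-cartesianProductWith f []       ys = refl
length-cartesianProductWith f (x ∷ xs) ys = begin
  length (map (f x) ys ++ cartesianProductWith f xs ys)   ≡⟨ length-++ (map (f x) ys) ⟩
  length (map (f x) ys) ℕ.+ length (cartesianProductWith f xs ys)
    ≡⟨ cong₂ ℕ._+_ (length-map (f x) ys) (length-cartesianProductWith f xs ys) ⟩
  length ys ℕ.+ length xs ℕ.* length ys   ∎
  where open ≡-Reasoning

module _ where
  open import Data.Integer using (_+_; _-_; _*_; _≤_; -_; 0ℤ)
  open import Data.Integer.Tactic.RingSolver using (solve-∀)
  open import Data.List.Extrema ℤP.≤-totalOrder using (min; max; argmin-sel; argmax-sel; min≤⊤; min≤xs; ⊥≤max; xs≤max)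

  interval : ℤ → ℕ → List ℤ
  interval lo n = applyUpTo (λ j → lo + + j) (suc n)

  length-interval : ∀ lo n → length (interval lo n) ≡ suc n
  length-interval lo n = length-applyUpTo (λ j → lo + + j) (suc n)

  ∈-interval⁺ : ∀ {lo n k} → lo ≤ k → k ≤ lo + + n → k ∈ interval lo n
  ∈-interval⁺ {lo} {n} {k} lo≤k k≤lo+n =
    subst (_∈ interval lo n) lo+j≡k (∈-applyUpTo⁺ (λ j → lo + + j) (s≤s (ℤP.drop‿+≤+ j≤n)))
    where
    open ℤP.≤-Reasoning
    j = ∣ k - lo ∣
    +j≡k-lo : + j ≡ k - lo
    +j≡k-lo = ℤP.0≤i⇒+∣i∣≡i (ℤP.i≤j⇒0≤j-i lo≤k)
    cancel₁ : ∀ lo k → lo + (k - lo) ≡ k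
    cancel₁ = solve-∀
    cancel₂ : ∀ lo n → (lo + n) - lo ≡ n
    cancel₂ = solve-∀
    lo+j≡k : lo + + j ≡ k
    lo+j≡k = trans (cong (λ t → lo + t) +j≡k-lo) (cancel₁ lo k)
    j≤n : + j ≤ + n
    j≤n = begin
      + j              ≡⟨ +j≡k-lo ⟩
      k - lo           ≤⟨ ℤP.+-monoˡ-≤ (- lo) k≤lo+n ⟩
      (lo + + n) - lo  ≡⟨ cancel₂ lo (+ n) ⟩
      + n              ∎

  symInterval : ℕ → List ℤ
  symInterval n = interval (- + n) (n ℕ.+ n)

  ∣i∣≤n⇒-n≤i≤n : ∀ {i n} → ∣ i ∣ ℕ.≤ n → - + n ≤ i × i ≤ + n
  ∣i∣≤n⇒-n≤i≤n {+ _}      {n}     ∣i∣≤n = ℤP.neg-≤-pos , +≤+ ∣i∣≤n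
  ∣i∣≤n⇒-n≤i≤n { -[1+ _ ]} {suc n} ∣i∣≤n = -≤- (ℕP.≤-pred ∣i∣≤n) , -≤+

  ∈-symInterval⁺ : ∀ {i n} → ∣ i ∣ ℕ.≤ n → i ∈ symInterval n
  ∈-symInterval⁺ {i} {n} ∣i∣≤n with ∣i∣≤n⇒-n≤i≤n ∣i∣≤n
  ... | -n≤i , i≤n = ∈-interval⁺ -n≤i (subst (i ≤_) (sym -n+[n+n]≡n) i≤n)
    where
    cancel : ∀ a → - a + (a + a) ≡ a
    cancel = solve-∀
    -n+[n+n]≡n : - + n + + (n ℕ.+ n) ≡ + n
    -n+[n+n]≡n = trans (cong (λ t → - + n + t) (ℤP.pos-+ n n)) (cancel (+ n))

  ∈-min : ∀ k ks → min k ks ∈ k ∷ ks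
  ∈-min k ks = [ here , there ]′ (argmin-sel id k ks)

  ∈-max : ∀ k ks → max k ks ∈ k ∷ ks
  ∈-max k ks = [ here , there ]′ (argmax-sel id k ks)

  Unique⇒length≤max-min : ∀ {k ks} → Unique (k ∷ ks) → length ks ℕ.≤ ∣ max k ks - min k ks ∣
  Unique⇒length≤max-min {k} {ks} u = ℕP.≤-pred (begin
      length (k ∷ ks)         ≤⟨ Unique⇒length≤ u ⊆interval ⟩
      length (interval lo n)  ≡⟨ length-interval lo n ⟩
      suc n                   ∎)
    where
    open ℕP.≤-Reasoning
    lo = min k ks
    hi = max k ks
    n = ∣ hi - lo ∣
    lo≤ : All (lo ≤_) (k ∷ ks)
    lo≤ = min≤⊤ k ks ∷ min≤xs k ks
    ≤hi : All (_≤ hi) (k ∷ ks)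
    ≤hi = ⊥≤max k ks ∷ xs≤max k ks
    cancel : ∀ lo hi → lo + (hi - lo) ≡ hi
    cancel = solve-∀
    hi≡lo+n : hi ≡ lo + + n
    hi≡lo+n = trans (sym (cancel lo hi))
      (cong (λ t → lo + t) (sym (ℤP.0≤i⇒+∣i∣≡i (ℤP.i≤j⇒0≤j-i (All.lookup ≤hi (∈-min k ks))))))
    ⊆interval : k ∷ ks ⊆ interval lo n
    ⊆interval {k′} k′∈ =
      ∈-interval⁺ (All.lookup lo≤ k′∈) (subst (k′ ≤_) hi≡lo+n (All.lookup ≤hi k′∈))

  ∣i-j∣≤n : ∀ {i j n} → 0ℤ ≤ i → i ≤ + n → 0ℤ ≤ j → j ≤ + n → ∣ i - j ∣ ℕ.≤ n
  ∣i-j∣≤n {+ a} {+ c} {n} _ (+≤+ a≤n) _ (+≤+ c≤n) =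
    subst (ℕ._≤ n) (cong ∣_∣ (sym (ℤP.m-n≡m⊖n a c)))
      (ℕP.≤-trans (ℤP.∣m⊝n∣≤m⊔n a c) (ℕP.⊔-lub a≤n c≤n))

  box : ∀ {d} → (Fin d → ℕ) → List (Point d)
  box {zero}  m = [ [] ]
  box {suc d} m = cartesianProductWith _∷_ (symInterval (m F.zero)) (box (m ∘ F.suc))

  length-box : ∀ {d} (m : Fin d → ℕ) → length (box m) ≡ prodFin (λ i → suc (m i ℕ.+ m i))
  length-box {zero}  m = refl
  length-box {suc d} m =
    trans (length-cartesianProductWith _∷_ (symInterval (m F.zero)) (box (m ∘ F.suc)))
      (cong₂ ℕ._*_ (length-interval (- + m F.zero) (m F.zero ℕ.+ m F.zero)) (length-box (m ∘ F.suc)))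

  ∈-box⁺ : ∀ {d} {m : Fin d → ℕ} {b : Point d} → (∀ i → ∣ lookup b i ∣ ℕ.≤ m i) → b ∈ box m
  ∈-box⁺ {zero}  {b = []}    _ = here refl
  ∈-box⁺ {suc d} {b = z ∷ b} ∣b∣≤m =
    ∈-cartesianProductWith⁺ _∷_ (∈-symInterval⁺ (∣b∣≤m F.zero)) (∈-box⁺ (∣b∣≤m ∘ F.suc))

  module _ {d : ℕ} {x b : Point d} where

    lookup-≡[mod] : ∀ {y} k → zipWith _-_ y x ≡ Vec.map (k *_) b →
      ∀ i → lookup y i - lookup x i ≡ k * lookup b i
    lookup-≡[mod] {y} k y-x≡kb i = begin
      lookup y i - lookup x i         ≡⟨ Vecₚ.lookup-zipWith _-_ i y x ⟨
      lookup (zipWith _-_ y x) i      ≡⟨ cong (λ v → lookup v i) y-x≡kb ⟩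
      lookup (Vec.map (k *_) b) i     ≡⟨ Vecₚ.lookup-map i (k *_) b ⟩
      k * lookup b i                  ∎
      where open ≡-Reasoning

    lookup-difference : ∀ {y y′} k k′ →
      zipWith _-_ y x ≡ Vec.map (k *_) b → zipWith _-_ y′ x ≡ Vec.map (k′ *_) b →
      ∀ i → lookup y i - lookup y′ i ≡ (k - k′) * lookup b i
    lookup-difference {y} {y′} k k′ e e′ i = begin
      lookup y i - lookup y′ i
        ≡⟨ rearrange (lookup y i) (lookup y′ i) (lookup x i) ⟩
      (lookup y i - lookup x i) - (lookup y′ i - lookup x i)
        ≡⟨ cong₂ _-_ (lookup-≡[mod] k e i) (lookup-≡[mod] k′ e′ i) ⟩
      k * lookup b i - k′ * lookup b i
        ≡⟨ distrib k k′ (lookup b i) ⟩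
      (k - k′) * lookup b i                                   ∎
      where
      open ≡-Reasoning
      rearrange : ∀ a a′ c → a - a′ ≡ (a - c) - (a′ - c)
      rearrange = solve-∀
      distrib : ∀ k k′ β → k * β - k′ * β ≡ (k - k′) * β
      distrib = solve-∀

    ≡[mod]-injective : ∀ {y y′} k →
      zipWith _-_ y x ≡ Vec.map (k *_) b → zipWith _-_ y′ x ≡ Vec.map (k *_) b → y ≡ y′
    ≡[mod]-injective {y} {y′} k e e′ = begin
      y                    ≡⟨ Vecₚ.tabulate∘lookup y ⟨
      tabulate (lookup y)  ≡⟨ Vecₚ.tabulate-cong yᵢ≡y′ᵢ ⟩
      tabulate (lookup y′) ≡⟨ Vecₚ.tabulate∘lookup y′ ⟩
      y′                   ∎
      where
      open ≡-Reasoning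
      yᵢ≡y′ᵢ : ∀ i → lookup y i ≡ lookup y′ i
      yᵢ≡y′ᵢ i = ℤP.i-j≡0⇒i≡j _ _ (trans (lookup-difference k k e e′ i)
        (trans (cong (_* lookup b i) (ℤP.+-inverseʳ k)) (ℤP.*-zeroˡ (lookup b i))))

    coefficients : ∀ {L} → All (_≡ x [mod b ]) L → List ℤ
    coefficients []             = []
    coefficients ((k , _) ∷ ps) = k ∷ coefficients ps

    length-coefficients : ∀ {L} (ps : All (_≡ x [mod b ]) L) → length (coefficients ps) ≡ length L
    length-coefficients []       = refl
    length-coefficients (_ ∷ ps) = cong suc (length-coefficients ps)

    ∈-coefficients⁻ : ∀ {L k} (ps : All (_≡ x [mod b ]) L) → k ∈ coefficients ps →
      ∃ λ y → y ∈ L × zipWith _-_ y x ≡ Vec.map (k *_) b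
    ∈-coefficients⁻ ((_ , e) ∷ ps) (here refl) = _ , here refl , e
    ∈-coefficients⁻ (_ ∷ ps)       (there k∈)  with ∈-coefficients⁻ ps k∈
    ... | y , y∈L , e = y , there y∈L , e

    Unique-coefficients : ∀ {L} (ps : All (_≡ x [mod b ]) L) → Unique L → Unique (coefficients ps)
    Unique-coefficients []             []         = []
    Unique-coefficients ((k , e) ∷ ps) (y∉L ∷ uL) = All.tabulate k≢ ∷ Unique-coefficients ps uL
      where
      k≢ : ∀ {k′} → k′ ∈ coefficients ps → k ≢ k′
      k≢ k′∈ refl with ∈-coefficients⁻ ps k′∈
      ... | y′ , y′∈L , e′ = All.lookup y∉L y′∈L (≡[mod]-injective k e e′)

    coefficient-gap : ∀ {N : Fin d → ℕ} {L k k′} → All (InBox N) L → (ps : All (_≡ x [mod b ]) L) →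
      k ∈ coefficients ps → k′ ∈ coefficients ps → ∀ i → ∣ k - k′ ∣ ℕ.* ∣ lookup b i ∣ ℕ.≤ N i
    coefficient-gap {N} {k = k} {k′} inBox ps k∈ k′∈ i
      with ∈-coefficients⁻ ps k∈ | ∈-coefficients⁻ ps k′∈
    ... | y , y∈L , e | y′ , y′∈L , e′
      with All.lookup inBox y∈L i | All.lookup inBox y′∈L i
    ... | 1≤yᵢ , yᵢ≤Nᵢ | 1≤y′ᵢ , y′ᵢ≤Nᵢ = begin
      ∣ k - k′ ∣ ℕ.* ∣ lookup b i ∣   ≡⟨ ℤP.abs-* (k - k′) (lookup b i) ⟨
      ∣ (k - k′) * lookup b i ∣       ≡⟨ cong ∣_∣ (lookup-difference k k′ e e′ i) ⟨
      ∣ lookup y i - lookup y′ i ∣    ≤⟨ ∣i-j∣≤n (0≤ 1≤yᵢ) yᵢ≤Nᵢ (0≤ 1≤y′ᵢ) y′ᵢ≤Nᵢ ⟩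
      N i                             ∎
      where
      open ℕP.≤-Reasoning
      0≤ : ∀ {a} → + 1 ≤ a → 0ℤ ≤ a
      0≤ = ℤP.≤-trans (+≤+ z≤n)

    length*∣b∣≤N : ∀ {N : Fin d → ℕ} {y L} → All (InBox N) (y ∷ L) → Unique (y ∷ L) →
      All (_≡ x [mod b ]) (y ∷ L) → ∀ i → length L ℕ.* ∣ lookup b i ∣ ℕ.≤ N i
    length*∣b∣≤N {N} {L = L} inBox u ps@((k , _) ∷ ps′) i = begin
      length L ℕ.* ∣ lookup b i ∣
        ≡⟨ cong (ℕ._* ∣ lookup b i ∣) (length-coefficients ps′) ⟨
      length ks ℕ.* ∣ lookup b i ∣
        ≤⟨ ℕP.*-monoˡ-≤ ∣ lookup b i ∣ (Unique⇒length≤max-min (Unique-coefficients ps u)) ⟩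
      ∣ max k ks - min k ks ∣ ℕ.* ∣ lookup b i ∣
        ≤⟨ coefficient-gap inBox ps (∈-max k ks) (∈-min k ks) i ⟩
      N i
        ∎
      where
      open ℕP.≤-Reasoning
      ks = coefficients ps′

open import Data.Nat using (_≤_; _*_; _+_; _^_; _/_)
open import Data.Nat.DivMod using (m*n/n≡m; m/n*n≤m; /-monoˡ-≤)
open import Data.Nat.Tactic.RingSolver using (solve-∀)

*≤⇒≤/ : ∀ m {n o} → suc m * n ≤ o → n ≤ o / suc m
*≤⇒≤/ m {n} {o} m*n≤o = begin
  n                   ≡⟨ m*n/n≡m n (suc m) ⟨
  n * suc m / suc m   ≤⟨ /-monoˡ-≤ (suc m) (subst (_≤ o) (ℕP.*-comm (suc m) n) m*n≤o) ⟩
  o / suc m           ∎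
  where open ℕP.≤-Reasoning

InU⇒∣b∣≤N/[s∸1] : ∀ {d} {N : Fin d → ℕ} {X b x} t → All (InBox N) X → InU X b (2 + t) x →
  ∀ i → ∣ lookup b i ∣ ≤ N i / suc t
InU⇒∣b∣≤N/[s∸1] t inBox (_ , [] , _ , () , _)
InU⇒∣b∣≤N/[s∸1] {N = N} {b = b} t inBox (_ , y ∷ L , u , |L|≡1+t , L⊆X,congruent) i
  with All.unzip L⊆X,congruent
... | L⊆X , congruent = *≤⇒≤/ t (subst (λ l → l * ∣ lookup b i ∣ ≤ N i) (ℕP.suc-injective |L|≡1+t)
        (length*∣b∣≤N (All.map (All.lookup inBox) L⊆X) u congruent i))

prodFin-* : ∀ {d} s (f : Fin d → ℕ) → s ^ d * prodFin f ≡ prodFin (λ i → s * f i)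
prodFin-* {zero}  s f = ℕP.*-identityʳ 1
prodFin-* {suc d} s f = begin
  s * s ^ d * (f F.zero * prodFin (f ∘ F.suc))
    ≡⟨ rearrange s (s ^ d) (f F.zero) (prodFin (f ∘ F.suc)) ⟩
  s * f F.zero * (s ^ d * prodFin (f ∘ F.suc))
    ≡⟨ cong (s * f F.zero *_) (prodFin-* s (f ∘ F.suc)) ⟩
  s * f F.zero * prodFin (λ i → s * f (F.suc i))
    ∎
  where
  open ≡-Reasoning
  rearrange : ∀ s a b c → s * a * (b * c) ≡ s * b * (a * c)
  rearrange = solve-∀

prodFin-mono-≤ : ∀ {d} {f g : Fin d → ℕ} → (∀ i → f i ≤ g i) → prodFin f ≤ prodFin g
prodFin-mono-≤ {zero}  f≤g = ℕP.≤-refl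
prodFin-mono-≤ {suc d} f≤g = ℕP.*-mono-≤ (f≤g F.zero) (prodFin-mono-≤ (f≤g ∘ F.suc))

s*[1+2⌊N/[s∸1]⌋]≤4N+s : ∀ t N → (2 + t) * suc (N / suc t + N / suc t) ≤ 4 * N + (2 + t)
s*[1+2⌊N/[s∸1]⌋]≤4N+s t N = begin
  s * suc (q + q)   ≡⟨ expand s q ⟩
  s + 2 * (s * q)   ≤⟨ ℕP.+-monoʳ-≤ s (ℕP.*-monoʳ-≤ 2 s*q≤2N) ⟩
  s + 2 * (2 * N)   ≡⟨ collect s N ⟩
  4 * N + s         ∎
  where
  open ℕP.≤-Reasoning
  s = 2 + t
  q = N / suc t
  expand : ∀ s q → s * suc (q + q) ≡ s + 2 * (s * q)
  expand = solve-∀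
  collect : ∀ s N → s + 2 * (2 * N) ≡ 4 * N + s
  collect = solve-∀
  double : ∀ t q → (2 + t) * q + t * q ≡ 2 * (q * suc t)
  double = solve-∀
  s*q≤2N : s * q ≤ 2 * N
  s*q≤2N = begin
    s * q             ≤⟨ ℕP.m≤m+n (s * q) (t * q) ⟩
    s * q + t * q     ≡⟨ double t q ⟩
    2 * (q * suc t)   ≤⟨ ℕP.*-monoʳ-≤ 2 (m/n*n≤m N (suc t)) ⟩
    2 * N             ∎

lemma2p3 : (d : ℕ) (N : Fin d → ℕ) → ((i : Fin d) → 1 ≤ N i) →
    (s : ℕ) → 2 ≤ s →
    (X : List (Point d)) → Unique X → All (InBox N) X →
    (P : List (Point d × Point d)) → Unique P →
    All (λ { (b , x) → (b ≢ 𝟎 d) × InU X b s x }) P →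
    s ^ d * length P ≤ length X * prodFin (λ i → 4 * N i + s)
lemma2p3 d N _ s@(suc (suc t)) (s≤s (s≤s z≤n)) X _ inBox P uP PinU = begin
  s ^ d * length P
    ≤⟨ ℕP.*-monoʳ-≤ (s ^ d) (Unique⇒length≤ uP P⊆B×X) ⟩
  s ^ d * length (cartesianProduct B X)
    ≡⟨ cong (s ^ d *_) (length-cartesianProductWith _,_ B X) ⟩
  s ^ d * (length B * length X)
    ≡⟨ rearrange (s ^ d) (length B) (length X) ⟩
  length X * (s ^ d * length B)
    ≡⟨ cong (λ l → length X * (s ^ d * l)) (length-box m) ⟩
  length X * (s ^ d * prodFin (λ i → suc (m i + m i)))
    ≡⟨ cong (length X *_) (prodFin-* s (λ i → suc (m i + m i))) ⟩
  length X * prodFin (λ i → s * suc (m i + m i))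
    ≤⟨ ℕP.*-monoʳ-≤ (length X) (prodFin-mono-≤ (λ i → s*[1+2⌊N/[s∸1]⌋]≤4N+s t (N i))) ⟩
  length X * prodFin (λ i → 4 * N i + s)
    ∎
  where
  open ℕP.≤-Reasoning
  m : Fin d → ℕ
  m i = N i / suc t
  B = box m
  P⊆B×X : P ⊆ cartesianProduct B X
  P⊆B×X {b , x} bx∈P with All.lookup PinU bx∈P
  ... | _ , x∈X , class = ∈-cartesianProduct⁺ (∈-box⁺ (InU⇒∣b∣≤N/[s∸1] t inBox (x∈X , class))) x∈X
  rearrange : ∀ a b c → a * (b * c) ≡ c * (a * b)
  rearrange = solve-∀
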